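{- Let $m$ be a positive integer. Let $Q_m=\{q \text{ prime}: H_m(q)=0\}$ and $S_m=\{n\in\mathbb{N}: q\nmid n \text{ for all } q\in Q_m\}$. Let $T_m$ be the unique set of positive integers determined by: (i) $1\in T_m$; (ii) a prime $p$ lies in $T_m$ if and only if $p-m\in T_m$; (iii) a composite $x$ lies in $T_m$ if and only if there exist $x_1,x_2\in T_m$ with $x_1,x_2>1$ and $x_1x_2=x$. Then $S_m=T_m$.
   Context: For $m,n\in\mathbb{N}$, the Schemmel totient function $L_m(n)$ is the number of integers $k\in\{1,\dots,n\}$ such that $\gcd(k+s,n)=1$ for all $s\in\{0,1,\dots,m-1\}$; by convention $L_m(0)=0$. Equivalently, $L_m(1)=1$, and for $n>1$ with $n=\prod_{i=1}^r p_i^{\alpha_i}$, $L_m(n)=0$ if the smallest prime factor of $n$ is $\le m$, and $L_m(n)=\prod_{i} p_i^{\alpha_i-1}(p_i-m)$ otherwise. Iterates: $f^{(1)}=f$, $f^{(k+1)}=f\circ f^{(k)}$. $R_m(n)$ is the least positive integer $k$ with $L_m^{(k)}(n)\in\{0,1\}$, and $H_m(n)=L_m^{(R_m(n))}(n)$. In (ii), $T_m\subseteq\mathbb{N}$, so $p-m\in T_m$ requires $p-m\ge 1$. -}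

module Defs where

open import Data.Nat using (ℕ; zero; suc; _+_; _*_; _∸_; _≤_; _<_)
open import Data.Nat.GCD using (gcd)
open import Data.Nat.Divisibility using (_∣_)
open import Data.Nat.Primality using (Prime; Composite)
open import Data.Bool using (Bool; true; false; _∧_; if_then_else_)
open import Data.Nat using (_≡ᵇ_)
open import Data.Product using (Σ; _×_; ∃-syntax)
open import Data.Sum using (_⊎_)
open import Relation.Binary.PropositionalEquality using (_≡_)
open import Relation.Nullary using (¬_)
open import Function.Bundles using (_⇔_)

good : ℕ → ℕ → ℕ → Bool
good zero    n k = true
good (suc s) n k = (gcd (k + s) n ≡ᵇ 1) ∧ good s n k

countGood : ℕ → ℕ → ℕ → ℕ
countGood m n zero    = 0
countGood m n (suc j) = (if good m n (suc j) then 1 else 0) + countGood m n j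

-- Schemmel totient L_m(n) (counting definition; L_m(0) = 0 automatically)
L : ℕ → ℕ → ℕ
L m n = countGood m n n

iter : (ℕ → ℕ) → ℕ → ℕ → ℕ
iter f zero    x = x
iter f (suc k) x = f (iter f k x)

ZeroOrOne : ℕ → Set
ZeroOrOne x = (x ≡ 0) ⊎ (x ≡ 1)

IsR : ℕ → ℕ → ℕ → Set
IsR m n k = (1 ≤ k) × ZeroOrOne (iter (L m) k n)
          × (∀ j → 1 ≤ j → j < k → ¬ ZeroOrOne (iter (L m) j n))

-- H_m(n) = 0, i.e. L_m^(R_m(n))(n) = 0
HIsZero : ℕ → ℕ → Set
HIsZero m n = ∃[ k ] (IsR m n k × iter (L m) k n ≡ 0)

InQ : ℕ → ℕ → Set
InQ m q = Prime q × HIsZero m q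

InS : ℕ → ℕ → Set
InS m n = (1 ≤ n) × (∀ q → InQ m q → ¬ (q ∣ n))

IsT : ℕ → (ℕ → Set) → Set
IsT m T =
  (∀ x → T x → 1 ≤ x)
  × T 1
  × (∀ p → Prime p → (T p ⇔ (m < p × T (p ∸ m))))
  × (∀ x → Composite x →
       (T x ⇔ (∃[ x₁ ] ∃[ x₂ ] (T x₁ × T x₂ × 1 < x₁ × 1 < x₂ × x₁ * x₂ ≡ x))))

-- Since L m is defined by counting, its arithmetic is read off the count: whether
-- k is counted depends only on k mod n, which gives L m (d * n) ≡ d * L m n for d ∣ n and, by
-- the Chinese remainder theorem, L m (a * b) ≡ L m a * L m b for coprime a, b; moreover
-- L m p ≡ p ∸ m for primes p, and L m n ≡ 0 once a prime q ≤ m divides n. Consequently q ∸ m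
-- divides L m n for every prime q ∣ n, and every prime factor of L m n divides n or some such
-- q ∸ m. As 1 is fixed by L m, H_m(n) = 0 just says that some iterate of n is 0, and since
-- L m n < n for n > 1, strong induction shows that n reaches 0 iff one of its prime factors
-- does. So S_m consists of the positive n that never reach 0; it satisfies (i)-(iii) because
-- a prime p reaches 0 iff p ∸ m does, and (i)-(iii) determine a set by strong induction.

module Submission where

open import Defs
open import Data.Nat using (ℕ; _≤_)
open import Data.Product using (_×_)
open import Function.Bundles using (_⇔_)
open import Data.Bool using (true; false; T; _∧_; if_then_else_)
open import Data.Bool.Properties using (T-∧)
open import Data.Empty using (⊥-elim)
open import Data.Nat
open import Data.Nat.Coprimality using (Coprime; coprime⇒gcd≡1; gcd≡1⇒coprime; coprime-Bézout)
open import Data.Nat.Divisibility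
open import Data.Nat.GCD using (gcd; module Bézout)
open import Data.Nat.Induction using (<-rec)
open import Data.Nat.Primality
open import Data.Nat.Properties
open import Data.Nat.Tactic.RingSolver using (solve-∀)
open import Data.Product using (_,_; proj₁; proj₂; ∃-syntax)
open import Data.Sum using (_⊎_; inj₁; inj₂; [_,_]′)
open import Function.Base using (_∘_)
open import Function.Bundles using (mk⇔; Equivalence)
open import Function.Construct.Symmetry using (⇔-sym)
open import Function.Properties.Equivalence using () renaming (trans to ⇔-trans)
open import Data.Product.Function.NonDependent.Propositional using (_×-⇔_)
open import Relation.Binary.PropositionalEquality
open import Relation.Nullary using (¬_; yes; no)
open import Relation.Nullary.Decidable using (_×-dec_)

∑< : ℕ → (ℕ → ℕ) → ℕ
∑< zero    f = 0
∑< (suc N) f = f N + ∑< N f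

syntax ∑< N (λ k → e) = ∑[ k < N ] e

∑-cong : ∀ N {f g : ℕ → ℕ} → (∀ k → k < N → f k ≡ g k) → ∑< N f ≡ ∑< N g
∑-cong zero    eq = refl
∑-cong (suc N) eq = cong₂ _+_ (eq N ≤-refl) (∑-cong N (λ k k<N → eq k (m<n⇒m<1+n k<N)))

∑-const : ∀ N c → ∑[ _ < N ] c ≡ N * c
∑-const zero    c = refl
∑-const (suc N) c = cong (c +_) (∑-const N c)

∑-+ : ∀ N (f g : ℕ → ℕ) → ∑[ k < N ] (f k + g k) ≡ ∑< N f + ∑< N g
∑-+ zero    f g = refl
∑-+ (suc N) f g = begin
  f N + g N + ∑[ k < N ] (f k + g k) ≡⟨ cong (f N + g N +_) (∑-+ N f g) ⟩
  f N + g N + (∑< N f + ∑< N g)      ≡⟨ interchange (f N) (g N) (∑< N f) (∑< N g) ⟩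
  f N + ∑< N f + (g N + ∑< N g)      ∎
  where
  open ≡-Reasoning
  interchange : ∀ a b c d → a + b + (c + d) ≡ a + c + (b + d)
  interchange = solve-∀

∑-*ˡ : ∀ N c (f : ℕ → ℕ) → ∑[ k < N ] (c * f k) ≡ c * ∑< N f
∑-*ˡ zero    c f = sym (*-zeroʳ c)
∑-*ˡ (suc N) c f = trans (cong (c * f N +_) (∑-*ˡ N c f)) (sym (*-distribˡ-+ c (f N) (∑< N f)))

∑-*ʳ : ∀ N c (f : ℕ → ℕ) → ∑[ k < N ] (f k * c) ≡ ∑< N f * c
∑-*ʳ N c f = begin
  ∑[ k < N ] (f k * c) ≡⟨ ∑-cong N (λ k _ → *-comm (f k) c) ⟩
  ∑[ k < N ] (c * f k) ≡⟨ ∑-*ˡ N c f ⟩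
  c * ∑< N f           ≡⟨ *-comm c (∑< N f) ⟩
  ∑< N f * c           ∎
  where open ≡-Reasoning

∑-split : ∀ M N (f : ℕ → ℕ) → ∑< (M + N) f ≡ ∑[ k < M ] f (k + N) + ∑< N f
∑-split zero    N f = refl
∑-split (suc M) N f = trans (cong (f (M + N) +_) (∑-split M N f)) (sym (+-assoc (f (M + N)) _ _))

∑-blocks : ∀ c n (f : ℕ → ℕ) → ∑< (c * n) f ≡ ∑[ j < c ] ∑[ i < n ] f (i + j * n)
∑-blocks zero    n f = refl
∑-blocks (suc c) n f = trans (∑-split n (c * n) f) (cong (∑[ i < n ] f (i + c * n) +_) (∑-blocks c n f))

∑-swap : ∀ a b (g : ℕ → ℕ → ℕ) → ∑[ i < a ] ∑[ j < b ] g i j ≡ ∑[ j < b ] ∑[ i < a ] g i j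
∑-swap zero    b g = sym (trans (∑-const b 0) (*-zeroʳ b))
∑-swap (suc a) b g = begin
  ∑< b (g a) + ∑[ i < a ] ∑[ j < b ] g i j     ≡⟨ cong (∑< b (g a) +_) (∑-swap a b g) ⟩
  ∑< b (g a) + ∑[ j < b ] ∑[ i < a ] g i j     ≡⟨ ∑-+ b (g a) (λ j → ∑[ i < a ] g i j) ⟨
  ∑[ j < b ] (g a j + ∑[ i < a ] g i j)        ∎
  where open ≡-Reasoning

∑-shift : ∀ N (g : ℕ → ℕ) → ∑[ k < N ] g (suc k) + g 0 ≡ ∑< N g + g N
∑-shift zero    g = refl
∑-shift (suc N) g = begin
  g (suc N) + ∑[ k < N ] g (suc k) + g 0   ≡⟨ +-assoc (g (suc N)) _ _ ⟩
  g (suc N) + (∑[ k < N ] g (suc k) + g 0) ≡⟨ cong (g (suc N) +_) (∑-shift N g) ⟩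
  g (suc N) + (∑< N g + g N)               ≡⟨ rotate (g (suc N)) (∑< N g) (g N) ⟩
  g N + ∑< N g + g (suc N)                 ∎
  where
  open ≡-Reasoning
  rotate : ∀ a b c → a + (b + c) ≡ c + b + a
  rotate = solve-∀

∑-zero : ∀ N (f : ℕ → ℕ) → (∀ k → k < N → f k ≡ 0) → ∑< N f ≡ 0
∑-zero N f f≡0 = trans (∑-cong N f≡0) (trans (∑-const N 0) (*-zeroʳ N))

∑-≤ : ∀ N c (f : ℕ → ℕ) → (∀ k → f k ≤ c) → ∑< N f ≤ N * c
∑-≤ zero    c f f≤c = z≤n
∑-≤ (suc N) c f f≤c = +-mono-≤ (f≤c N) (∑-≤ N c f f≤c)

term≤∑ : ∀ N (f : ℕ → ℕ) {k} → k < N → f k ≤ ∑< N f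
term≤∑ (suc N) f k<1+N with m<1+n⇒m<n∨m≡n k<1+N
... | inj₁ k<N  = ≤-trans (term≤∑ N f k<N) (m≤n+m (∑< N f) (f N))
... | inj₂ refl = m≤m+n (f N) (∑< N f)

Periodic : ℕ → (ℕ → ℕ) → Set
Periodic n f = ∀ k → f (k + n) ≡ f k

periodic-* : ∀ {n f} → Periodic n f → ∀ c k → f (k + c * n) ≡ f k
periodic-* {n} {f} per zero    k = cong f (+-identityʳ k)
periodic-* {n} {f} per (suc c) k = begin
  f (k + (n + c * n)) ≡⟨ cong f (reorder k n (c * n)) ⟩
  f (k + c * n + n)   ≡⟨ per (k + c * n) ⟩
  f (k + c * n)       ≡⟨ periodic-* per c k ⟩
  f k                 ∎
  where
  open ≡-Reasoning
  reorder : ∀ x y z → x + (y + z) ≡ x + z + y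
  reorder = solve-∀

∑-periodic-shift : ∀ {n f} → Periodic n f → ∀ t → ∑[ k < n ] f (k + t) ≡ ∑< n f
∑-periodic-shift {n} {f} per zero    = ∑-cong n (λ k _ → cong f (+-identityʳ k))
∑-periodic-shift {n} {f} per (suc t) = trans shift-by-one (∑-periodic-shift per t)
  where
  g : ℕ → ℕ
  g k = f (k + t)
  shift-by-one : ∑[ k < n ] f (k + suc t) ≡ ∑< n g
  shift-by-one = +-cancelʳ-≡ _ _ _ (begin
    ∑[ k < n ] f (k + suc t) + g 0 ≡⟨ cong (_+ g 0) (∑-cong n (λ k _ → cong f (+-suc k t))) ⟩
    ∑[ k < n ] g (suc k) + g 0     ≡⟨ ∑-shift n g ⟩
    ∑< n g + g n                   ≡⟨ cong (∑< n g +_) (trans (cong f (+-comm n t)) (per t)) ⟩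
    ∑< n g + g 0                   ∎)
    where open ≡-Reasoning

∑-periodic-* : ∀ {n f} → Periodic n f → ∀ c → ∑< (c * n) f ≡ c * ∑< n f
∑-periodic-* {n} {f} per c = begin
  ∑< (c * n) f                         ≡⟨ ∑-blocks c n f ⟩
  ∑[ j < c ] ∑[ i < n ] f (i + j * n)  ≡⟨ ∑-cong c (λ j _ → ∑-periodic-shift per (j * n)) ⟩
  ∑[ _ < c ] ∑< n f                    ≡⟨ ∑-const c (∑< n f) ⟩
  c * ∑< n f                           ∎
  where open ≡-Reasoning

periodic-coprime⇒const : ∀ {a b f} → Periodic a f → Periodic b f → Bézout.Identity 1 a b →
                         ∀ i → f i ≡ f 0
periodic-coprime⇒const {a} {b} {f} per-a per-b bézout = const
  where
  open ≡-Reasoning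
  step : Bézout.Identity 1 a b → ∀ i → f (suc i) ≡ f i
  step (Bézout.+- x y 1+yb≡xa) i = begin
    f (suc i)           ≡⟨ periodic-* per-b y (suc i) ⟨
    f (suc i + y * b)   ≡⟨ cong f (+-suc i (y * b)) ⟨
    f (i + suc (y * b)) ≡⟨ cong (λ j → f (i + j)) 1+yb≡xa ⟩
    f (i + x * a)       ≡⟨ periodic-* per-a x i ⟩
    f i                 ∎
  step (Bézout.-+ x y 1+xa≡yb) i = begin
    f (suc i)           ≡⟨ periodic-* per-a x (suc i) ⟨
    f (suc i + x * a)   ≡⟨ cong f (+-suc i (x * a)) ⟨
    f (i + suc (x * a)) ≡⟨ cong (λ j → f (i + j)) 1+xa≡yb ⟩
    f (i + y * b)       ≡⟨ periodic-* per-b y i ⟩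
    f i                 ∎
  const : ∀ i → f i ≡ f 0
  const zero    = refl
  const (suc i) = trans (step bézout i) (const i)

∑-periodic-product : ∀ {p n} {A B : ℕ → ℕ} .{{_ : NonZero p}} →
                     Periodic p A → Periodic n B → Coprime p n →
                     ∑[ k < p * n ] (A k * B k) ≡ ∑< p A * ∑< n B
∑-periodic-product {p} {n} {A} {B} per-A per-B coprime = begin
  ∑[ k < p * n ] (A k * B k)                        ≡⟨ ∑-blocks p n (λ k → A k * B k) ⟩
  ∑[ j < p ] ∑[ i < n ] (A (i + j * n) * B (i + j * n))
    ≡⟨ ∑-cong p (λ j _ → ∑-cong n (λ i _ → cong (A (i + j * n) *_) (periodic-* per-B j i))) ⟩
  ∑[ j < p ] ∑[ i < n ] (A (i + j * n) * B i)       ≡⟨ ∑-swap n p (λ i j → A (i + j * n) * B i) ⟨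
  ∑[ i < n ] ∑[ j < p ] (A (i + j * n) * B i)       ≡⟨ ∑-cong n (λ i _ → ∑-*ʳ p (B i) (λ j → A (i + j * n))) ⟩
  ∑[ i < n ] (c i * B i)                            ≡⟨ ∑-cong n (λ i _ → cong (_* B i) (c≡∑A i)) ⟩
  ∑[ i < n ] (∑< p A * B i)                         ≡⟨ ∑-*ˡ n (∑< p A) B ⟩
  ∑< p A * ∑< n B                                   ∎
  where
  open ≡-Reasoning
  -- c has the coprime periods p and n, hence is constant: this replaces the Chinese
  -- remainder bijection between ℕ/pn and ℕ/p × ℕ/n.
  c : ℕ → ℕ
  c i = ∑[ j < p ] A (i + j * n)
  c-periodic-p : Periodic p c
  c-periodic-p i = ∑-cong p (λ j _ → trans (cong A (reorder i p (j * n))) (per-A (i + j * n)))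
    where
    reorder : ∀ x y z → x + y + z ≡ x + z + y
    reorder = solve-∀
  c-periodic-n : Periodic n c
  c-periodic-n i = begin
    ∑[ j < p ] A (i + n + j * n)  ≡⟨ ∑-cong p (λ j _ → cong A (shift i j n)) ⟩
    ∑[ j < p ] g (j + 1)          ≡⟨ ∑-periodic-shift g-periodic 1 ⟩
    c i                           ∎
    where
    g : ℕ → ℕ
    g j = A (i + j * n)
    g-periodic : Periodic p g
    g-periodic j = trans (cong A (expand i j p n)) (periodic-* per-A n (i + j * n))
      where
      expand : ∀ i j p n → i + (j + p) * n ≡ i + j * n + n * p
      expand = solve-∀
    shift : ∀ i j n → i + n + j * n ≡ i + (j + 1) * n
    shift = solve-∀
  c-const : ∀ i → c i ≡ c 0
  c-const = periodic-coprime⇒const c-periodic-p c-periodic-n (coprime-Bézout coprime)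
  c≡∑A : ∀ i → c i ≡ ∑< p A
  c≡∑A i = trans (c-const i) (*-cancelˡ-≡ (c 0) (∑< p A) p (begin
    p * c 0                              ≡⟨ ∑-const p (c 0) ⟨
    ∑[ _ < p ] c 0                       ≡⟨ ∑-cong p (λ i _ → c-const i) ⟨
    ∑[ i < p ] ∑[ j < p ] A (i + j * n)  ≡⟨ ∑-swap p p (λ i j → A (i + j * n)) ⟩
    ∑[ j < p ] ∑[ i < p ] A (i + j * n)  ≡⟨ ∑-cong p (λ j _ → ∑-periodic-shift per-A (j * n)) ⟩
    ∑[ _ < p ] ∑< p A                    ≡⟨ ∑-const p (∑< p A) ⟩
    p * ∑< p A                           ∎))

prime-factor : ∀ {n} → 1 < n → ∃[ q ] (Prime q × q ∣ n)
prime-factor {n} = <-rec (λ n → 1 < n → ∃[ q ] (Prime q × q ∣ n)) go n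
  where
  go : ∀ n → (∀ {k} → k < n → 1 < k → ∃[ q ] (Prime q × q ∣ k)) → 1 < n → ∃[ q ] (Prime q × q ∣ n)
  go n rec 1<n with prime? n
  ... | yes n-prime = n , n-prime , ∣-refl
  ... | no ¬n-prime with ¬prime⇒composite {{n>1⇒nonTrivial 1<n}} ¬n-prime
  ... | composite {d} d<n d∣n with rec d<n (nonTrivial⇒n>1 d)
  ... | q , q-prime , q∣d = q , q-prime , ∣-trans q∣d d∣n

prime∣prime⇒≡ : ∀ {q p} → Prime q → Prime p → q ∣ p → q ≡ p
prime∣prime⇒≡ q-prime p-prime q∣p with prime⇒irreducible p-prime q∣p
... | inj₁ refl = ⊥-elim (¬prime[1] q-prime)
... | inj₂ q≡p  = q≡p

prime∤1 : ∀ {q} → Prime q → ¬ q ∣ 1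
prime∤1 q-prime q∣1 = ¬prime[1] (subst Prime (∣1⇒≡1 q∣1) q-prime)

coprime⇔noCommonPrimeFactor : ∀ {a b} → Coprime a b ⇔ (∀ q → Prime q → q ∣ b → ¬ q ∣ a)
coprime⇔noCommonPrimeFactor {a} {b} = mk⇔ to from
  where
  to : Coprime a b → ∀ q → Prime q → q ∣ b → ¬ q ∣ a
  to coprime q q-prime q∣b q∣a = ¬prime[1] (subst Prime (coprime (q∣a , q∣b)) q-prime)
  from : (∀ q → Prime q → q ∣ b → ¬ q ∣ a) → Coprime a b
  from none {zero}        (0∣a , 0∣b) = ⊥-elim (none 2 prime[2] (subst (2 ∣_) (sym (0∣⇒≡0 0∣b)) (2 ∣0))
                                                                (subst (2 ∣_) (sym (0∣⇒≡0 0∣a)) (2 ∣0)))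
  from none {suc zero}    _           = refl
  from none {suc (suc d)} (d∣a , d∣b) with prime-factor {suc (suc d)} (s≤s (s≤s z≤n))
  ... | q , q-prime , q∣d = ⊥-elim (none q q-prime (∣-trans q∣d d∣b) (∣-trans q∣d d∣a))

prime∤⇒coprime : ∀ {p n} → Prime p → ¬ p ∣ n → Coprime p n
prime∤⇒coprime {p} p-prime p∤n = Equivalence.from coprime⇔noCommonPrimeFactor
  λ q q-prime q∣n q∣p → p∤n (subst (_∣ _) (prime∣prime⇒≡ q-prime p-prime q∣p) q∣n)

Admissible : ℕ → ℕ → ℕ → Set
Admissible m n k = ∀ q → Prime q → q ∣ n → ∀ s → s < m → ¬ q ∣ k + s

T-good⇔admissible : ∀ m n k → T (good m n k) ⇔ Admissible m n k
T-good⇔admissible zero    n k = mk⇔ (λ _ q _ _ s ()) _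
T-good⇔admissible (suc m) n k = mk⇔ to from
  where
  coprime⇔ : gcd (k + m) n ≡ 1 ⇔ (∀ q → Prime q → q ∣ n → ¬ q ∣ k + m)
  coprime⇔ = mk⇔ (Equivalence.to coprime⇔noCommonPrimeFactor ∘ gcd≡1⇒coprime)
                 (coprime⇒gcd≡1 ∘ Equivalence.from coprime⇔noCommonPrimeFactor)
  to : T (good (suc m) n k) → Admissible (suc m) n k
  to t q q-prime q∣n s s<1+m with Equivalence.to (T-∧ {gcd (k + m) n ≡ᵇ 1}) t | m<1+n⇒m<n∨m≡n s<1+m
  ... | _ , t-rest | inj₁ s<m  = Equivalence.to (T-good⇔admissible m n k) t-rest q q-prime q∣n s s<m
  ... | t-gcd , _  | inj₂ refl = Equivalence.to coprime⇔ (≡ᵇ⇒≡ _ 1 t-gcd) q q-prime q∣n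
  from : Admissible (suc m) n k → T (good (suc m) n k)
  from adm = Equivalence.from (T-∧ {gcd (k + m) n ≡ᵇ 1})
    ( ≡⇒≡ᵇ _ 1 (Equivalence.from coprime⇔ (λ q q-prime q∣n → adm q q-prime q∣n m (n<1+n m)))
    , Equivalence.from (T-good⇔admissible m n k) (λ q q-prime q∣n s s<m → adm q q-prime q∣n s (m<n⇒m<1+n s<m)))

admissible-* : ∀ m a b k → Admissible m (a * b) k ⇔ (Admissible m a k × Admissible m b k)
admissible-* m a b k = mk⇔ to from
  where
  to : Admissible m (a * b) k → Admissible m a k × Admissible m b k
  to adm = (λ q q-prime q∣a → adm q q-prime (∣-trans q∣a (m∣m*n b)))
         , (λ q q-prime q∣b → adm q q-prime (∣-trans q∣b (n∣m*n a)))
  from : Admissible m a k × Admissible m b k → Admissible m (a * b) k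
  from (adm-a , adm-b) q q-prime q∣ab with euclidsLemma a b q-prime q∣ab
  ... | inj₁ q∣a = adm-a q q-prime q∣a
  ... | inj₂ q∣b = adm-b q q-prime q∣b

admissible-∣ : ∀ {m d n k} → d ∣ n → Admissible m n k → Admissible m d k
admissible-∣ d∣n adm q q-prime q∣d = adm q q-prime (∣-trans q∣d d∣n)

admissible-periodic : ∀ m n k → Admissible m n (k + n) ⇔ Admissible m n k
admissible-periodic m n k = mk⇔
  (λ adm q q-prime q∣n s s<m q∣k+s →
     adm q q-prime q∣n s s<m (subst (q ∣_) (sym (reorder k n s)) (∣m∣n⇒∣m+n q∣n q∣k+s)))
  (λ adm q q-prime q∣n s s<m q∣k+n+s →
     adm q q-prime q∣n s s<m (∣m+n∣m⇒∣n (subst (q ∣_) (reorder k n s) q∣k+n+s) q∣n))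
  where
  reorder : ∀ x y z → x + y + z ≡ y + (x + z)
  reorder = solve-∀

T-injective : ∀ {x y} → (T x ⇔ T y) → x ≡ y
T-injective {false} {false} _    = refl
T-injective {false} {true}  x⇔y = ⊥-elim (Equivalence.from x⇔y _)
T-injective {true}  {false} x⇔y = ⊥-elim (Equivalence.to x⇔y _)
T-injective {true}  {true}  _    = refl

good-cong : ∀ {m n k m' n' k'} → Admissible m n k ⇔ Admissible m' n' k' → good m n k ≡ good m' n' k'
good-cong adm⇔ =
  T-injective (⇔-trans (T-good⇔admissible _ _ _) (⇔-trans adm⇔ (⇔-sym (T-good⇔admissible _ _ _))))

good-* : ∀ m a b k → good m (a * b) k ≡ good m a k ∧ good m b k
good-* m a b k = T-injective (⇔-trans (T-good⇔admissible m (a * b) k) (⇔-trans (admissible-* m a b k)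
  (⇔-sym (⇔-trans (T-∧ {good m a k}) (T-good⇔admissible m a k ×-⇔ T-good⇔admissible m b k)))))

-- χ m n k records whether k + 1 is counted, matching the range 1, …, n of the count L m n.
χ : ℕ → ℕ → ℕ → ℕ
χ m n k = if good m n (suc k) then 1 else 0

L≡∑χ : ∀ m n → L m n ≡ ∑< n (χ m n)
L≡∑χ m n = countGood≡∑χ n
  where
  countGood≡∑χ : ∀ j → countGood m n j ≡ ∑< j (χ m n)
  countGood≡∑χ zero    = refl
  countGood≡∑χ (suc j) = cong (χ m n j +_) (countGood≡∑χ j)

χ≡1 : ∀ {m n k} → Admissible m n (suc k) → χ m n k ≡ 1
χ≡1 {m} {n} {k} adm with good m n (suc k) | Equivalence.from (T-good⇔admissible m n (suc k))
... | true  | _          = refl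
... | false | admissible = ⊥-elim (admissible adm)

χ≡0 : ∀ {m n k} → ¬ Admissible m n (suc k) → χ m n k ≡ 0
χ≡0 {m} {n} {k} ¬adm with good m n (suc k) | Equivalence.to (T-good⇔admissible m n (suc k))
... | true  | admissible = ⊥-elim (¬adm (admissible _))
... | false | _          = refl

χ≤1 : ∀ m n k → χ m n k ≤ 1
χ≤1 m n k with good m n (suc k)
... | true  = ≤-refl
... | false = z≤n

χ-periodic : ∀ m n → Periodic n (χ m n)
χ-periodic m n k = cong (if_then 1 else 0) (good-cong (admissible-periodic m n (suc k)))

χ-* : ∀ m a b k → χ m (a * b) k ≡ χ m a k * χ m b k
χ-* m a b k rewrite good-* m a b (suc k) with good m a (suc k)
... | true  = sym (+-identityʳ _)
... | false = refl

L-1 : ∀ m → L m 1 ≡ 1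
L-1 m = cong (_+ 0) (χ≡1 {m} {1} {0} λ q q-prime q∣1 → ⊥-elim (prime∤1 q-prime q∣1))

L-* : ∀ m {a b} .{{_ : NonZero a}} → Coprime a b → L m (a * b) ≡ L m a * L m b
L-* m {a} {b} coprime = begin
  L m (a * b)                            ≡⟨ L≡∑χ m (a * b) ⟩
  ∑< (a * b) (χ m (a * b))               ≡⟨ ∑-cong (a * b) (λ k _ → χ-* m a b k) ⟩
  ∑[ k < a * b ] (χ m a k * χ m b k)     ≡⟨ ∑-periodic-product (χ-periodic m a) (χ-periodic m b) coprime ⟩
  ∑< a (χ m a) * ∑< b (χ m b)            ≡⟨ cong₂ _*_ (L≡∑χ m a) (L≡∑χ m b) ⟨
  L m a * L m b                          ∎
  where open ≡-Reasoning

L-∣* : ∀ m {d n} → d ∣ n → L m (d * n) ≡ d * L m n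
L-∣* m {d} {n} d∣n = begin
  L m (d * n)               ≡⟨ L≡∑χ m (d * n) ⟩
  ∑< (d * n) (χ m (d * n))  ≡⟨ ∑-cong (d * n) (λ k _ → cong (if_then 1 else 0) (good-cong admissible⇔)) ⟩
  ∑< (d * n) (χ m n)        ≡⟨ ∑-periodic-* (χ-periodic m n) d ⟩
  d * ∑< n (χ m n)          ≡⟨ cong (d *_) (L≡∑χ m n) ⟨
  d * L m n                 ∎
  where
  open ≡-Reasoning
  admissible⇔ : ∀ {k} → Admissible m (d * n) k ⇔ Admissible m n k
  admissible⇔ {k} = mk⇔ (proj₂ ∘ Equivalence.to (admissible-* m d n k))
                        (λ adm → Equivalence.from (admissible-* m d n k) (admissible-∣ d∣n adm , adm))

multiple-in-window : ∀ d k → ∃[ s ] (s < suc d × suc d ∣ k + s)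
multiple-in-window d zero = 0 , s≤s z≤n , (suc d ∣0)
multiple-in-window d (suc k) with multiple-in-window d k
... | zero  , _     , d+1∣k = d , n<1+n d , subst (suc d ∣_) (+-suc k d)
                                              (∣m∣n⇒∣m+n (subst (suc d ∣_) (+-identityʳ k) d+1∣k) ∣-refl)
... | suc s , s<1+d , d+1∣k+s+1 = s , <-trans (n<1+n s) s<1+d , subst (suc d ∣_) (+-suc k s) d+1∣k+s+1

L≡0 : ∀ m {n q} → Prime q → q ≤ m → q ∣ n → L m n ≡ 0
L≡0 m {n} {q@(suc d)} q-prime q≤m q∣n = trans (L≡∑χ m n) (∑-zero n (χ m n) λ k _ → χ≡0 λ adm →
  let s , s<q , q∣k+1+s = multiple-in-window d (suc k)
  in adm q q-prime q∣n s (<-≤-trans s<q q≤m) q∣k+1+s)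

L-prime : ∀ m {p} → Prime p → L m p ≡ p ∸ m
L-prime m {p} p-prime with m <? p
... | no  m≮p = trans (L≡0 m p-prime (≮⇒≥ m≮p) ∣-refl) (sym (m≤n⇒m∸n≡0 (≮⇒≥ m≮p)))
... | yes m<p = begin
  L m p                                               ≡⟨ L≡∑χ m p ⟩
  ∑< p (χ m p)                                        ≡⟨ cong (λ N → ∑< N (χ m p)) (m+[n∸m]≡n m≤p) ⟨
  ∑< (m + (p ∸ m)) (χ m p)                            ≡⟨ ∑-split m (p ∸ m) (χ m p) ⟩
  ∑[ k < m ] χ m p (k + (p ∸ m)) + ∑< (p ∸ m) (χ m p) ≡⟨ cong₂ _+_ top-count bottom-count ⟩
  0 + (p ∸ m)                                         ∎
  where
  open ≡-Reasoning
  m≤p = <⇒≤ m<p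
  -- k + 1 is admissible iff the window k + 1, …, k + m misses p, i.e. iff k < p ∸ m.
  top-inadmissible : ∀ k → k < m → ¬ Admissible m p (suc (k + (p ∸ m)))
  top-inadmissible k k<m adm = adm p p-prime ∣-refl (m ∸ suc k) (∸-monoʳ-< (s≤s z≤n) k<m)
    (subst (p ∣_) (sym sum≡p) ∣-refl)
    where
    sum≡p : suc (k + (p ∸ m)) + (m ∸ suc k) ≡ p
    sum≡p = begin
      suc (k + (p ∸ m)) + (m ∸ suc k) ≡⟨ cong (_+ (m ∸ suc k)) (+-comm (suc k) (p ∸ m)) ⟩
      p ∸ m + suc k + (m ∸ suc k)     ≡⟨ +-assoc (p ∸ m) (suc k) _ ⟩
      p ∸ m + (suc k + (m ∸ suc k))   ≡⟨ cong (p ∸ m +_) (m+[n∸m]≡n k<m) ⟩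
      p ∸ m + m                       ≡⟨ m∸n+n≡m m≤p ⟩
      p                               ∎
  bottom-admissible : ∀ k → k < p ∸ m → Admissible m p (suc k)
  bottom-admissible k k<p∸m q q-prime q∣p s s<m p∣k+1+s
    with refl ← prime∣prime⇒≡ q-prime p-prime q∣p =
    <⇒≱ (subst (suc k + s <_) (m∸n+n≡m m≤p) (+-mono-≤-< k<p∸m s<m)) (∣⇒≤ p∣k+1+s)
  top-count : ∑[ k < m ] χ m p (k + (p ∸ m)) ≡ 0
  top-count = ∑-zero m _ λ k k<m → χ≡0 (top-inadmissible k k<m)
  bottom-count : ∑< (p ∸ m) (χ m p) ≡ p ∸ m
  bottom-count = trans (∑-cong (p ∸ m) (λ k k<p∸m → χ≡1 (bottom-admissible k k<p∸m)))
                       (trans (∑-const (p ∸ m) 1) (*-identityʳ (p ∸ m)))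

L< : ∀ {m n} → 1 ≤ m → 1 < n → L m n < n
L< {m} {n@(suc n-1)} 1≤m 1<n with prime-factor 1<n
... | q , q-prime , q∣n = begin-strict
  L m n                            ≡⟨ L≡∑χ m n ⟩
  χ m n n-1 + ∑< n-1 (χ m n)       ≡⟨ cong (_+ ∑< n-1 (χ m n)) (χ≡0 last-inadmissible) ⟩
  ∑< n-1 (χ m n)                   ≤⟨ ∑-≤ n-1 1 (χ m n) (χ≤1 m n) ⟩
  n-1 * 1                          ≡⟨ *-identityʳ n-1 ⟩
  n-1                              <⟨ n<1+n n-1 ⟩
  n                                ∎
  where
  open ≤-Reasoning
  last-inadmissible : ¬ Admissible m n n
  last-inadmissible adm = adm q q-prime q∣n 0 1≤m (subst (q ∣_) (sym (+-identityʳ n)) q∣n)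

L-pos : ∀ {m n} → 1 ≤ n → (∀ q → Prime q → q ∣ n → m < q) → 1 ≤ L m n
L-pos {m} {n} 1≤n rough = begin
  1              ≡⟨ χ≡1 first-admissible ⟨
  χ m n 0        ≤⟨ term≤∑ n (χ m n) 1≤n ⟩
  ∑< n (χ m n)   ≡⟨ L≡∑χ m n ⟨
  L m n          ∎
  where
  open ≤-Reasoning
  first-admissible : Admissible m n 1
  first-admissible q q-prime q∣n s s<m q∣1+s = <⇒≱ (≤-<-trans s<m (rough q q-prime q∣n)) (∣⇒≤ q∣1+s)

L-prime-* : ∀ m {p} n → Prime p → (p ∣ n × L m (p * n) ≡ p * L m n) ⊎ L m (p * n) ≡ (p ∸ m) * L m n
L-prime-* m {p} n p-prime with p ∣? n
... | yes p∣n = inj₁ (p∣n , L-∣* m p∣n)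
... | no  p∤n = inj₂ (trans (L-* m {{prime⇒nonZero p-prime}} (prime∤⇒coprime p-prime p∤n))
                            (cong (_* L m n) (L-prime m p-prime)))

∸-∣-L : ∀ m {q} n → Prime q → q ∣ n → q ∸ m ∣ L m n
∸-∣-L m {q} n q-prime = <-rec (λ n → q ∣ n → q ∸ m ∣ L m n) go n
  where
  instance _ = prime⇒nonTrivial q-prime
  go : ∀ n → (∀ {k} → k < n → q ∣ k → q ∸ m ∣ L m k) → q ∣ n → q ∸ m ∣ L m n
  go zero      _   _   = _ ∣0
  go n@(suc _) rec q∣n = subst (λ x → q ∸ m ∣ L m x) (sym (m∣n⇒n≡m*quotient q∣n))
                                (by-recurrence (L-prime-* m n′ q-prime))
    where
    n′ = quotient q∣n
    by-recurrence : (q ∣ n′ × L m (q * n′) ≡ q * L m n′) ⊎ L m (q * n′) ≡ (q ∸ m) * L m n′ →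
                    q ∸ m ∣ L m (q * n′)
    by-recurrence (inj₁ (q∣n′ , eq)) = subst (q ∸ m ∣_) (sym eq)
                                         (∣-trans (rec (quotient-< q∣n) q∣n′) (n∣m*n q))
    by-recurrence (inj₂ eq)          = subst (q ∸ m ∣_) (sym eq) (m∣m*n (L m n′))

L-primeFactor : ∀ m {r} n → Prime r → r ∣ L m n → r ∣ n ⊎ ∃[ q ] (Prime q × q ∣ n × r ∣ q ∸ m)
L-primeFactor m {r} n r-prime = <-rec (λ n → r ∣ L m n → Source n) go n
  where
  Source : ℕ → Set
  Source n = r ∣ n ⊎ ∃[ q ] (Prime q × q ∣ n × r ∣ q ∸ m)
  lift : ∀ {d n} → d ∣ n → Source d → Source n
  lift d∣n (inj₁ r∣d)                         = inj₁ (∣-trans r∣d d∣n)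
  lift d∣n (inj₂ (q , q-prime , q∣d , r∣q∸m)) = inj₂ (q , q-prime , ∣-trans q∣d d∣n , r∣q∸m)
  go : ∀ n → (∀ {k} → k < n → r ∣ L m k → Source k) → r ∣ L m n → Source n
  go zero            _   _   = inj₁ (r ∣0)
  go (suc zero)      _   r∣L = ⊥-elim (prime∤1 r-prime (subst (r ∣_) (L-1 m) r∣L))
  go n@(suc (suc _)) rec r∣L with prime-factor {n} (s≤s (s≤s z≤n))
  ... | p , p-prime , p∣n = subst Source (sym n≡p*n′) (by-recurrence (L-prime-* m n′ p-prime)
                                                                    (subst (λ x → r ∣ L m x) n≡p*n′ r∣L))
    where
    instance _ = prime⇒nonTrivial p-prime
    n′ = quotient p∣n
    n≡p*n′ = m∣n⇒n≡m*quotient p∣n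
    from-L-n′ : r ∣ L m n′ → Source (p * n′)
    from-L-n′ r∣L′ = lift (n∣m*n p) (rec (quotient-< p∣n) r∣L′)
    by-recurrence : (p ∣ n′ × L m (p * n′) ≡ p * L m n′) ⊎ L m (p * n′) ≡ (p ∸ m) * L m n′ →
                    r ∣ L m (p * n′) → Source (p * n′)
    by-recurrence (inj₁ (_ , eq)) r∣L with euclidsLemma p (L m n′) r-prime (subst (r ∣_) eq r∣L)
    ... | inj₁ r∣p  = inj₁ (∣-trans r∣p (m∣m*n n′))
    ... | inj₂ r∣L′ = from-L-n′ r∣L′
    by-recurrence (inj₂ eq) r∣L with euclidsLemma (p ∸ m) (L m n′) r-prime (subst (r ∣_) eq r∣L)
    ... | inj₁ r∣p∸m = inj₂ (p , p-prime , m∣m*n n′ , r∣p∸m)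
    ... | inj₂ r∣L′  = from-L-n′ r∣L′

ReachesZero : ℕ → ℕ → Set
ReachesZero m n = ∃[ k ] iter (L m) k n ≡ 0

iter-suc : ∀ (f : ℕ → ℕ) k x → iter f (suc k) x ≡ iter f k (f x)
iter-suc f zero    x = refl
iter-suc f (suc k) x = cong f (iter-suc f k x)

iter-fixed : ∀ (f : ℕ → ℕ) {x} → f x ≡ x → ∀ k → iter f k x ≡ x
iter-fixed f fx≡x zero    = refl
iter-fixed f fx≡x (suc k) = trans (cong f (iter-fixed f fx≡x k)) fx≡x

¬reachesZero-1 : ∀ m → ¬ ReachesZero m 1
¬reachesZero-1 m (k , iter≡0) with () ← trans (sym (iter-fixed (L m) (L-1 m) k)) iter≡0

reachesZero-L : ∀ m {n} → ReachesZero m n → ReachesZero m (L m n)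
reachesZero-L m (zero  , refl)   = 0 , refl
reachesZero-L m (suc k , iter≡0) = k , trans (sym (iter-suc (L m) k _)) iter≡0

reachesZero-L⁻¹ : ∀ m {n} → ReachesZero m (L m n) → ReachesZero m n
reachesZero-L⁻¹ m (k , iter≡0) = suc k , trans (iter-suc (L m) k _) iter≡0

reachesZero-prime : ∀ m {p} → Prime p → ReachesZero m p ⇔ ReachesZero m (p ∸ m)
reachesZero-prime m p-prime = mk⇔
  (subst (ReachesZero m) (L-prime m p-prime) ∘ reachesZero-L m)
  (reachesZero-L⁻¹ m ∘ subst (ReachesZero m) (sym (L-prime m p-prime)))

L≡0⇒HIsZero : ∀ {m n} → L m n ≡ 0 → HIsZero m n
L≡0⇒HIsZero L≡0 = 1 , (≤-refl , inj₁ L≡0 , λ j 1≤j j<1 _ → <⇒≱ j<1 1≤j) , L≡0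

HIsZero-L⁻¹ : ∀ {m} n → HIsZero m (L m n) → HIsZero m n
HIsZero-L⁻¹ {m} n hz with L m n in L≡
... | zero     = L≡0⇒HIsZero L≡
... | suc zero = ⊥-elim (¬reachesZero-1 m (proj₁ hz , proj₂ (proj₂ hz)))
HIsZero-L⁻¹ {m} n (k , (_ , _ , earlier) , iter≡0) | suc (suc a) =
  suc k , (s≤s z≤n , inj₁ iter′≡0 , earlier′) , iter′≡0
  where
  shifted : ∀ j → iter (L m) (suc j) n ≡ iter (L m) j (suc (suc a))
  shifted j = trans (iter-suc (L m) j n) (cong (iter (L m) j) L≡)
  iter′≡0 : iter (L m) (suc k) n ≡ 0
  iter′≡0 = trans (shifted k) iter≡0
  earlier′ : ∀ j → 1 ≤ j → j < suc k → ¬ ZeroOrOne (iter (L m) j n)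
  earlier′ (suc zero)    _ _         zo with subst ZeroOrOne L≡ zo
  ... | inj₁ ()
  ... | inj₂ ()
  earlier′ (suc (suc j)) _ (s≤s j<k) zo =
    earlier (suc j) (s≤s z≤n) j<k (subst ZeroOrOne (shifted (suc j)) zo)

HIsZero⇔reachesZero : ∀ m n → HIsZero m n ⇔ ReachesZero m n
HIsZero⇔reachesZero m n = mk⇔ (λ (k , _ , iter≡0) → k , iter≡0) (λ (k , iter≡0) → from k iter≡0)
  where
  from : ∀ k {n} → iter (L m) k n ≡ 0 → HIsZero m n
  from zero    refl   = L≡0⇒HIsZero refl
  from (suc k) iter≡0 = HIsZero-L⁻¹ _ (from k (trans (sym (iter-suc (L m) k _)) iter≡0))

PrimeFactorReachingZero : ℕ → ℕ → Set
PrimeFactorReachingZero m n = ∃[ q ] (Prime q × q ∣ n × ReachesZero m q)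

reachesZero⇔primeFactor-rough : ∀ {m n} → 1 ≤ m → 1 < n → (∀ q → Prime q → q ∣ n → m < q) →
  (∀ {k} → k < n → 1 ≤ k → ReachesZero m k ⇔ PrimeFactorReachingZero m k) →
  ReachesZero m n ⇔ PrimeFactorReachingZero m n
reachesZero⇔primeFactor-rough {m} {n} 1≤m 1<n rough ih = mk⇔ to from
  where
  at-L : ReachesZero m (L m n) ⇔ PrimeFactorReachingZero m (L m n)
  at-L = ih (L< 1≤m 1<n) (L-pos (<⇒≤ 1<n) rough)
  at-shifted : ∀ {q} → Prime q → q ∣ n → ReachesZero m q ⇔ PrimeFactorReachingZero m (q ∸ m)
  at-shifted {q} q-prime q∣n = ⇔-trans (reachesZero-prime m q-prime)
    (ih (<-≤-trans (∸-monoʳ-< 1≤m (<⇒≤ m<q)) (∣⇒≤ q∣n)) (m<n⇒0<n∸m m<q))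
    where
    instance _ = >-nonZero (<-trans z<s 1<n)
    m<q = rough q q-prime q∣n
  to : ReachesZero m n → PrimeFactorReachingZero m n
  to rz with Equivalence.to at-L (reachesZero-L m rz)
  ... | r , r-prime , r∣L , rz-r with L-primeFactor m n r-prime r∣L
  ... | inj₁ r∣n = r , r-prime , r∣n , rz-r
  ... | inj₂ (q , q-prime , q∣n , r∣q∸m) =
    q , q-prime , q∣n , Equivalence.from (at-shifted q-prime q∣n) (r , r-prime , r∣q∸m , rz-r)
  from : PrimeFactorReachingZero m n → ReachesZero m n
  from (q , q-prime , q∣n , rz-q) with Equivalence.to (at-shifted q-prime q∣n) rz-q
  ... | r , r-prime , r∣q∸m , rz-r = reachesZero-L⁻¹ m
    (Equivalence.from at-L (r , r-prime , ∣-trans r∣q∸m (∸-∣-L m n q-prime q∣n) , rz-r))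

reachesZero⇔primeFactor : ∀ {m} → 1 ≤ m → ∀ n → 1 ≤ n → ReachesZero m n ⇔ PrimeFactorReachingZero m n
reachesZero⇔primeFactor {m} 1≤m = <-rec (λ n → 1 ≤ n → ReachesZero m n ⇔ PrimeFactorReachingZero m n) go
  where
  go : ∀ n → (∀ {k} → k < n → 1 ≤ k → ReachesZero m k ⇔ PrimeFactorReachingZero m k) →
       1 ≤ n → ReachesZero m n ⇔ PrimeFactorReachingZero m n
  go (suc zero) _ _ = mk⇔ (⊥-elim ∘ ¬reachesZero-1 m)
                          (λ (_ , q-prime , q∣1 , _) → ⊥-elim (prime∤1 q-prime q∣1))
  go n@(suc (suc _)) ih _ with anyUpTo? (λ q → prime? q ×-dec q ∣? n) (suc m)
  ... | yes (q , q<1+m , q-prime , q∣n) =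
    mk⇔ (λ _ → q , q-prime , q∣n , 1 , L≡0 m q-prime (m<1+n⇒m≤n q<1+m) ∣-refl)
        (λ _ → 1 , L≡0 m q-prime (m<1+n⇒m≤n q<1+m) q∣n)
  ... | no no-small-factor = reachesZero⇔primeFactor-rough 1≤m (s≤s (s≤s z≤n)) rough ih
    where
    rough : ∀ q → Prime q → q ∣ n → m < q
    rough q q-prime q∣n = ≰⇒> λ q≤m → no-small-factor (q , s≤s q≤m , q-prime , q∣n)

InS⇔¬reachesZero : ∀ {m n} → 1 ≤ m → InS m n ⇔ (1 ≤ n × ¬ ReachesZero m n)
InS⇔¬reachesZero {m} {n} 1≤m = mk⇔
  (λ (1≤n , avoids) → 1≤n , λ rz →
    let q , q-prime , q∣n , rz-q = Equivalence.to (reachesZero⇔primeFactor 1≤m n 1≤n) rz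
    in avoids q (q-prime , Equivalence.from (HIsZero⇔reachesZero m q) rz-q) q∣n)
  (λ (1≤n , ¬rz) → 1≤n , λ q (q-prime , hz) q∣n →
    ¬rz (Equivalence.from (reachesZero⇔primeFactor 1≤m n 1≤n)
          (q , q-prime , q∣n , Equivalence.to (HIsZero⇔reachesZero m q) hz)))

InS-∣ : ∀ {m d n} → 1 ≤ d → d ∣ n → InS m n → InS m d
InS-∣ 1≤d d∣n (_ , avoids) = 1≤d , λ q q∈Q q∣d → avoids q q∈Q (∣-trans q∣d d∣n)

InS-* : ∀ {m a b} → InS m a → InS m b → InS m (a * b)
InS-* {a = a} {b} (1≤a , avoids-a) (1≤b , avoids-b) = *-mono-≤ 1≤a 1≤b , λ q q∈Q q∣ab →
  [ avoids-a q q∈Q , avoids-b q q∈Q ]′ (euclidsLemma a b (proj₁ q∈Q) q∣ab)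

InS-isT : ∀ {m} → 1 ≤ m → IsT m (InS m)
InS-isT {m} 1≤m = (λ _ → proj₁) , InS-1 , prime-clause , composite-clause
  where
  InS-1 : InS m 1
  InS-1 = ≤-refl , λ q (q-prime , _) q∣1 → prime∤1 q-prime q∣1
  prime-clause : ∀ p → Prime p → InS m p ⇔ (m < p × InS m (p ∸ m))
  prime-clause p p-prime = mk⇔ to from
    where
    to : InS m p → m < p × InS m (p ∸ m)
    to p∈S = m<p , Equivalence.from (InS⇔¬reachesZero 1≤m) (m<n⇒0<n∸m m<p , ¬rz-p∸m)
      where
      ¬rz-p∸m : ¬ ReachesZero m (p ∸ m)
      ¬rz-p∸m = proj₂ (Equivalence.to (InS⇔¬reachesZero 1≤m) p∈S)
              ∘ Equivalence.from (reachesZero-prime m p-prime)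
      m<p : m < p
      m<p = ≰⇒> λ p≤m → ¬rz-p∸m (0 , m≤n⇒m∸n≡0 p≤m)
    from : m < p × InS m (p ∸ m) → InS m p
    from (_ , p∸m∈S) = Equivalence.from (InS⇔¬reachesZero 1≤m)
      ( >-nonZero⁻¹ p {{prime⇒nonZero p-prime}}
      , proj₂ (Equivalence.to (InS⇔¬reachesZero 1≤m) p∸m∈S) ∘ Equivalence.to (reachesZero-prime m p-prime))
  composite-clause : ∀ x → Composite x →
    InS m x ⇔ (∃[ x₁ ] ∃[ x₂ ] (InS m x₁ × InS m x₂ × 1 < x₁ × 1 < x₂ × x₁ * x₂ ≡ x))
  composite-clause x (composite {d} d<x d∣x) = mk⇔
    (λ x∈S → d , quotient d∣x , InS-∣ (<⇒≤ 1<d) d∣x x∈S , InS-∣ (<⇒≤ 1<e) (quotient-∣ d∣x) x∈S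
           , 1<d , 1<e , sym (m∣n⇒n≡m*quotient d∣x))
    (λ (_ , _ , x₁∈S , x₂∈S , _ , _ , x₁x₂≡x) → subst (InS m) x₁x₂≡x (InS-* x₁∈S x₂∈S))
    where
    1<d = nonTrivial⇒n>1 d
    1<e = quotient>1 d∣x d<x

factors< : ∀ {a b} → 1 < a → 1 < b → a < a * b × b < a * b
factors< {a@(suc _)} {b@(suc _)} 1<a 1<b = m<m*n a b 1<b , subst (b <_) (*-comm b a) (m<m*n b a 1<a)

IsT-unique : ∀ {m} → 1 ≤ m → ∀ {T T′} → IsT m T → IsT m T′ → ∀ n → T n → T′ n
IsT-unique {m} 1≤m {T} {T′} (pos , _ , T-prime , T-composite) (_ , T′-1 , T′-prime , T′-composite) =
  <-rec (λ n → T n → T′ n) go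
  where
  go : ∀ n → (∀ {k} → k < n → T k → T′ k) → T n → T′ n
  go zero               _  t = ⊥-elim (<⇒≱ (pos 0 t) z≤n)
  go (suc zero)         _  _ = T′-1
  go n@(suc (suc _)) ih t with prime? n
  ... | yes n-prime =
    let m<n , t′ = Equivalence.to (T-prime n n-prime) t
    in Equivalence.from (T′-prime n n-prime) (m<n , ih (∸-monoʳ-< 1≤m (<⇒≤ m<n)) t′)
  ... | no ¬n-prime =
    let n-composite = ¬prime⇒composite ¬n-prime
        x₁ , x₂ , t₁ , t₂ , 1<x₁ , 1<x₂ , x₁x₂≡n = Equivalence.to (T-composite n n-composite) t
        x₁<x₁x₂ , x₂<x₁x₂ = factors< 1<x₁ 1<x₂
    in Equivalence.from (T′-composite n n-composite)
         ( x₁ , x₂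
         , ih (subst (x₁ <_) x₁x₂≡n x₁<x₁x₂) t₁ , ih (subst (x₂ <_) x₁x₂≡n x₂<x₁x₂) t₂
         , 1<x₁ , 1<x₂ , x₁x₂≡n)

theorem1p2 : (m : ℕ) → 1 ≤ m →
    IsT m (InS m) × ((T : ℕ → Set) → IsT m T → (n : ℕ) → (T n ⇔ InS m n))
theorem1p2 m 1≤m = InS-isT 1≤m , λ T T-isT n →
  mk⇔ (IsT-unique 1≤m T-isT (InS-isT 1≤m) n) (IsT-unique 1≤m (InS-isT 1≤m) T-isT n)
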